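{- Let $N\ge 2$ and let $A_1,A_2,\ldots$ be a quasifibonacci sequence of level $N$. Let $k\ge1$ and let $n$ be an integer with $A_1+A_2+\cdots+A_{k-1}<n<A_{k+1}$. Then every $a\in S_n$ satisfies $l(a)=k$.
   Context: For an integer $N\ge 2$, a sequence $A_1,A_2,\ldots$ of positive integers is a quasifibonacci sequence of level $N$ if $A_{k+N}=A_{k+N-1}+\cdots+A_k$ for all $k\ge 1$, and $A_k>A_{k-1}+\cdots+A_1$ for all $1\le k\le N$. Let $\{0,1\}^{\omega}$ be the set of sequences $(a_1,a_2,\ldots)$ with $a_i\in\{0,1\}$ and $a_i=0$ for all but finitely many $i$. For an integer $n\ge 0$, $S_n=\{a\in\{0,1\}^{\omega}:\sum_{i\ge1}a_iA_i=n\}$. For a nonzero $a\in\{0,1\}^\omega$, the length $l(a)$ is the largest $i$ with $a_i=1$. -}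

module Defs where

open import Data.Nat using (ℕ; zero; suc; _+_; _∸_; _<_; _≤_)
open import Data.Bool using (Bool; true; false)
open import Relation.Binary.PropositionalEquality using (_≡_)

-- Sequences are indexed from 1; the value at index 0 is ignored.

sumTo : (ℕ → ℕ) → ℕ → ℕ
sumTo f zero = 0
sumTo f (suc m) = sumTo f m + f (suc m)

sumFrom : (ℕ → ℕ) → ℕ → ℕ → ℕ
sumFrom f k zero = 0
sumFrom f k (suc m) = f k + sumFrom f (suc k) m

record Quasifibonacci (N : ℕ) (A : ℕ → ℕ) : Set where
  field
    positive   : ∀ k → 1 ≤ k → 0 < A k
    recurrence : ∀ k → 1 ≤ k → A (k + N) ≡ sumFrom A k N
    initial    : ∀ k → 1 ≤ k → k ≤ N → sumTo A (k ∸ 1) < A k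

bit : Bool → ℕ
bit true = 1
bit false = 0

-- An element of {0,1}^ω: a 0/1 sequence (indexed from 1) together with a
-- bound beyond which all entries are 0.
record FinSupp : Set where
  field
    seq   : ℕ → Bool
    bound : ℕ
    vanish : ∀ i → bound < i → seq i ≡ false
open FinSupp public

-- Σ_{i ≥ 1} a_i A_i  (finite sum, computed up to the support bound)
value : (ℕ → ℕ) → FinSupp → ℕ
value A a = sumTo (λ i → bit (seq a i) * A i) (bound a)
  where open import Data.Nat using (_*_)

InS : (ℕ → ℕ) → ℕ → FinSupp → Set
InS A n a = value A a ≡ n

HasLength : FinSupp → ℕ → Set
HasLength a k = (1 ≤ k) × (seq a k ≡ true) × (∀ i → k < i → seq a i ≡ false)
  where open import Data.Product using (_×_)

module Submission where

-- A quasifibonacci sequence is nondecreasing from index 1 on: inside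
-- the initial block A_{j+1} exceeds A_1 + ... + A_j ≥ A_j, and afterwards
-- A_{j+1} is a sum of N consecutive earlier terms whose last one is A_j.
-- Now let a ∈ S_n with A_1 + ... + A_{k-1} < n < A_{k+1}.
--   * No digit a_i with i > k is set: otherwise n ≥ A_i ≥ A_{k+1} > n.
--   * Hence if a_k were 0, all digits from index k on vanish and
--     n ≤ A_1 + ... + A_{k-1} < n.
-- So a_k = 1 is the last set digit, i.e. l(a) = k.

open import Defs
open import Data.Nat using (ℕ; zero; suc; _<_; _≤_; _∸_; _+_; _*_; z≤n; s≤s; _≤?_)
open import Data.Nat.Properties
open import Data.Bool using (true; false)
open import Data.Product using (_,_)
open import Data.Sum using (inj₁; inj₂)
open import Relation.Nullary using (yes; no; contradiction)
open import Relation.Binary.PropositionalEquality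

sumTo-mono : (g : ℕ → ℕ) → ∀ {m n} → m ≤ n → sumTo g m ≤ sumTo g n
sumTo-mono g {n = zero} z≤n = ≤-refl
sumTo-mono g {n = suc n} m≤1+n with m≤n⇒m<n∨m≡n m≤1+n
... | inj₁ (s≤s m≤n) = ≤-trans (sumTo-mono g m≤n) (m≤m+n _ _)
... | inj₂ refl      = ≤-refl

term≤sumTo : (f : ℕ → ℕ) → ∀ i m → 1 ≤ i → i ≤ m → f i ≤ sumTo f m
term≤sumTo f (suc i) m _ i≤m = ≤-trans (m≤n+m _ _) (sumTo-mono f i≤m)

sumTo-vanishing : (g : ℕ → ℕ) → ∀ c → (∀ i → c < i → g i ≡ 0) →
                  ∀ m → sumTo g m ≤ sumTo g c
sumTo-vanishing g c vanish zero = z≤n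
sumTo-vanishing g c vanish (suc m) with suc m ≤? c
... | yes 1+m≤c = sumTo-mono g 1+m≤c
... | no 1+m≰c  = begin
  sumTo g m + g (suc m) ≡⟨ cong (sumTo g m +_) (vanish (suc m) (≰⇒> 1+m≰c)) ⟩
  sumTo g m + 0         ≡⟨ +-identityʳ _ ⟩
  sumTo g m             ≤⟨ sumTo-vanishing g c vanish m ⟩
  sumTo g c             ∎
  where open ≤-Reasoning

sumTo-pointwise : (g h : ℕ → ℕ) → (∀ i → g i ≤ h i) → ∀ m → sumTo g m ≤ sumTo h m
sumTo-pointwise g h g≤h zero    = z≤n
sumTo-pointwise g h g≤h (suc m) = +-mono-≤ (sumTo-pointwise g h g≤h m) (g≤h (suc m))

last≤sumFrom : (f : ℕ → ℕ) → ∀ t m → f (t + m) ≤ sumFrom f t (suc m)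
last≤sumFrom f t zero    rewrite +-identityʳ t = m≤m+n (f t) 0
last≤sumFrom f t (suc m) rewrite +-suc t m =
  ≤-trans (last≤sumFrom f (suc t) m) (m≤n+m _ (f t))

module Monotone (M : ℕ) (A : ℕ → ℕ) (Q : Quasifibonacci (suc M) A) where
  open Quasifibonacci Q

  step : ∀ j → 1 ≤ j → A j ≤ A (suc j)
  step j 1≤j with suc j ≤? suc M
  -- initial block: A_j ≤ A_1 + ... + A_j < A_{j+1}
  ... | yes j+1≤N = ≤-trans (term≤sumTo A j j 1≤j ≤-refl)
                            (<⇒≤ (initial (suc j) (s≤s z≤n) j+1≤N))
  -- recurrence: with t = j - M, A_{j+1} = A_t + ... + A_j ≥ A_j
  ... | no j+1≰N  = subst₂ (λ x y → A x ≤ A y) t+M≡j t+N≡1+j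
      (subst (A (t + M) ≤_) (sym (recurrence t 1≤t)) (last≤sumFrom A t M))
    where
    M<j : M < j
    M<j = ≤-pred (≰⇒> j+1≰N)
    t : ℕ
    t = j ∸ M
    1≤t : 1 ≤ t
    1≤t = m<n⇒0<n∸m M<j
    t+M≡j : t + M ≡ j
    t+M≡j = m∸n+n≡m (<⇒≤ M<j)
    t+N≡1+j : t + suc M ≡ suc j
    t+N≡1+j = trans (+-suc t M) (cong suc t+M≡j)

  shift : ∀ i d → 1 ≤ i → A i ≤ A (d + i)
  shift i zero    1≤i = ≤-refl
  shift i (suc d) 1≤i = ≤-trans (shift i d 1≤i) (step (d + i) (≤-trans 1≤i (m≤n+m i d)))

  mono : ∀ {i j} → 1 ≤ i → i ≤ j → A i ≤ A j
  mono {i} {j} 1≤i i≤j = subst (λ x → A i ≤ A x) (m∸n+n≡m i≤j) (shift i (j ∸ i) 1≤i)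

digitTerm : (A : ℕ → ℕ) → FinSupp → ℕ → ℕ
digitTerm A a i = bit (seq a i) * A i

digitTerm≤ : (A : ℕ → ℕ) (a : FinSupp) → ∀ i → digitTerm A a i ≤ A i
digitTerm≤ A a i with seq a i
... | true  = ≤-reflexive (+-identityʳ (A i))
... | false = z≤n

selected≤value : (A : ℕ → ℕ) (a : FinSupp) → ∀ i → 1 ≤ i → seq a i ≡ true →
                 A i ≤ value A a
selected≤value A a i 1≤i ai≡true with i ≤? bound a
... | no i≰bound  = contradiction (trans (sym ai≡true) (vanish a i (≰⇒> i≰bound))) λ ()
... | yes i≤bound = subst (_≤ value A a) full (term≤sumTo (digitTerm A a) i (bound a) 1≤i i≤bound)
  where
  full : digitTerm A a i ≡ A i
  full rewrite ai≡true = +-identityʳ (A i)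

value≤prefix : (A : ℕ → ℕ) (a : FinSupp) → ∀ c → (∀ i → c < i → seq a i ≡ false) →
               value A a ≤ sumTo A c
value≤prefix A a c unset = ≤-trans
  (sumTo-vanishing (digitTerm A a) c vanishAbove (bound a))
  (sumTo-pointwise (digitTerm A a) A (digitTerm≤ A a) c)
  where
  vanishAbove : ∀ i → c < i → digitTerm A a i ≡ 0
  vanishAbove i c<i rewrite unset i c<i = refl

lemma2p1 : (N : ℕ) → 2 ≤ N → (A : ℕ → ℕ) → Quasifibonacci N A →
    (k : ℕ) → 1 ≤ k → (n : ℕ) → sumTo A (k ∸ 1) < n → n < A (suc k) →
    (a : FinSupp) → InS A n a → HasLength a k
-- The index of the statement is matched as suc k, so that k ∸ 1 reduces to k;
-- N ≥ 2 is only used through N = suc M ≥ 1.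
lemma2p1 (suc M) _ A Q (suc k) 1≤k n lo hi a refl = 1≤k , lastSet , noneAbove
  where
  open Monotone M A Q using (mono)

  -- a set digit i > suc k would force n ≥ A_i ≥ A_{suc (suc k)} > n
  noneAbove : ∀ i → suc k < i → seq a i ≡ false
  noneAbove i k<i with seq a i in ai
  ... | false = refl
  ... | true  = contradiction
        (≤-trans (mono (s≤s z≤n) k<i) (selected≤value A a i (≤-trans 1≤k (<⇒≤ k<i)) ai))
        (<⇒≱ hi)

  -- if digit suc k were unset, n ≤ A_1 + ... + A_k < n
  lastSet : seq a (suc k) ≡ true
  lastSet with seq a (suc k) in ak
  ... | true  = refl
  ... | false = contradiction (value≤prefix A a k unsetFromK) (<⇒≱ lo)
    where
    unsetFromK : ∀ i → k < i → seq a i ≡ false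
    unsetFromK i k<i with m≤n⇒m<n∨m≡n k<i
    ... | inj₁ k+1<i = noneAbove i k+1<i
    ... | inj₂ refl  = ak
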